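{- Let $V$ be a finite set with $|V|>2$. Then every switching class of tournaments on $V$ contains at least two non-isomorphic tournaments.
   Context: For a tournament $T$ on $V$ and $X\subseteq V$, $T^X$ is the tournament obtained from $T$ by reversing the orientations of all edges between $X$ and $V\setminus X$. Tournaments $T_1,T_2$ on $V$ are switching equivalent if $T_2=T_1^X$ for some $X\subseteq V$; this is an equivalence relation whose equivalence classes are called switching classes. -}

module Defs where

open import Data.Nat using (ℕ)
open import Data.Fin using (Fin)
open import Data.Bool using (Bool; true; false; not; _xor_; if_then_else_)
open import Relation.Binary.PropositionalEquality using (_≡_; sym)
open import Relation.Nullary using (¬_)
open import Data.Product using (Σ; ∃; _×_)
open import Function.Bundles using (_↔_; Inverse)

record Tournament (n : ℕ) : Set where
  field
    arc        : Fin n → Fin n → Bool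
    irreflexive : ∀ i → arc i i ≡ false
    antisym     : ∀ i j → ¬ (i ≡ j) → arc j i ≡ not (arc i j)
open Tournament public

Subset : ℕ → Set
Subset n = Fin n → Bool

switchArc : ∀ {n} → Tournament n → Subset n → Fin n → Fin n → Bool
switchArc T X i j = if X i xor X j then arc T j i else arc T i j

switch-irr : ∀ {n} (T : Tournament n) (X : Subset n) i → switchArc T X i i ≡ false
switch-irr T X i with X i
... | true  = irreflexive T i
... | false = irreflexive T i

switch-anti : ∀ {n} (T : Tournament n) (X : Subset n) i j → ¬ (i ≡ j) →
              switchArc T X j i ≡ not (switchArc T X i j)
switch-anti T X i j i≢j with X i | X j
... | true  | true  = antisym T i j i≢j
... | true  | false = antisym T j i (λ e → i≢j (sym e))
... | false | true  = antisym T j i (λ e → i≢j (sym e))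
... | false | false = antisym T i j i≢j

_^_ : ∀ {n} → Tournament n → Subset n → Tournament n
T ^ X = record
  { arc = switchArc T X
  ; irreflexive = switch-irr T X
  ; antisym = switch-anti T X }

SwitchingEquivalent : ∀ {n} → Tournament n → Tournament n → Set
SwitchingEquivalent T₁ T₂ = ∃ λ X → ∀ i j → arc T₂ i j ≡ arc (T₁ ^ X) i j

Isomorphic : ∀ {n} → Tournament n → Tournament n → Set
Isomorphic {n} T₁ T₂ =
  Σ (Fin n ↔ Fin n) λ σ → ∀ i j → arc T₂ (Inverse.to σ i) (Inverse.to σ j) ≡ arc T₁ i j

module Submission where

open import Defs
open import Data.Nat using (ℕ; _<_; _+_; suc; s≤s)
open import Data.Fin using (Fin; zero; suc)
open import Data.Fin.Properties using (_≟_; any?; all?)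
open import Data.Bool using (true; false; not; _xor_; if_then_else_)
open import Data.Bool.Properties
  using (xor-comm; xor-same; xor-inverseˡ; xor-∧-commutativeRing)
  renaming (_≟_ to _≟ᵇ_)
open import Data.Product using (Σ; ∃; _×_; _,_; proj₁; proj₂; map₂; swap)
open import Function.Base using (case_of_)
open import Function.Bundles using (Inverse)
open import Relation.Nullary using (¬_; yes; no; does; ¬?; _×-dec_; _→-dec_)
open import Relation.Nullary.Decidable using (Dec; dec-true; dec-false)
open import Relation.Binary.PropositionalEquality
  using (_≡_; _≢_; ≢-sym; refl; sym; trans; cong; subst; module ≡-Reasoning)
open import Algebra.Bundles using (CommutativeRing)
open import Algebra.Properties.CommutativeSemigroup
  (CommutativeRing.+-commutativeSemigroup xor-∧-commutativeRing)
  using (interchange)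

-- Switching at the in-neighbourhood of a vertex turns it into a source, and
-- having a source is an isomorphism invariant. So it suffices to find, in the
-- switching class of a tournament T with source s, a tournament without one.
-- If no u ≠ s beats every vertex other than s, switch at {s}: s becomes a
-- sink and nothing else can become a source. Otherwise switch at {u}: then u
-- loses to a third vertex, s loses to u, and every other vertex loses to s.

⁅_⁆ : ∀ {n} → Fin n → Subset n
⁅ u ⁆ k = does (k ≟ u)

_⊕_ : ∀ {n} → Subset n → Subset n → Subset n
(X ⊕ Y) k = X k xor Y k

inNeighbours : ∀ {n} → Tournament n → Fin n → Subset n
inNeighbours T v k = arc T k v

⁅⁆-self : ∀ {n} (u : Fin n) → ⁅ u ⁆ u ≡ true
⁅⁆-self u = dec-true (u ≟ u) refl

⁅⁆-other : ∀ {n} {u k : Fin n} → k ≢ u → ⁅ u ⁆ k ≡ false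
⁅⁆-other {u = u} {k} k≢u = dec-false (k ≟ u) k≢u

arc-asym : ∀ {n} (T : Tournament n) {i j} → i ≢ j → arc T i j ≡ true → arc T j i ≡ false
arc-asym T {i} {j} i≢j i→j = trans (antisym T i j i≢j) (cong not i→j)

if-xor : ∀ {A : Set} a b (x y : A) →
         (if a xor b then y else x) ≡ (if b then (if a then x else y) else (if a then y else x))
if-xor false false x y = refl
if-xor false true  x y = refl
if-xor true  false x y = refl
if-xor true  true  x y = refl

switch-switch : ∀ {n} (T : Tournament n) X Y i j → arc ((T ^ X) ^ Y) i j ≡ arc (T ^ (X ⊕ Y)) i j
switch-switch T X Y i j = begin
  (if Y i xor Y j then (if X j xor X i then arc T i j else arc T j i)
                  else (if X i xor X j then arc T j i else arc T i j))
    ≡⟨ cong (λ b → if Y i xor Y j then (if b then arc T i j else arc T j i)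
                                  else (if X i xor X j then arc T j i else arc T i j))
            (xor-comm (X j) (X i)) ⟩
  (if Y i xor Y j then (if X i xor X j then arc T i j else arc T j i)
                  else (if X i xor X j then arc T j i else arc T i j))
    ≡⟨ sym (if-xor (X i xor X j) (Y i xor Y j) (arc T i j) (arc T j i)) ⟩
  (if (X i xor X j) xor (Y i xor Y j) then arc T j i else arc T i j)
    ≡⟨ cong (λ b → if b then arc T j i else arc T i j) (interchange (X i) (X j) (Y i) (Y j)) ⟩
  (if (X i xor Y i) xor (X j xor Y j) then arc T j i else arc T i j)
    ∎
  where open ≡-Reasoning

switch-agree : ∀ {n} (T : Tournament n) X {i j} → X i ≡ X j → arc (T ^ X) i j ≡ arc T i j
switch-agree T X {i} {j} Xi≡Xj rewrite Xi≡Xj | xor-same (X j) = refl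

switch-differ : ∀ {n} (T : Tournament n) X {i j} → X i ≡ not (X j) → arc (T ^ X) i j ≡ arc T j i
switch-differ T X {i} {j} Xi≡¬Xj rewrite Xi≡¬Xj | xor-inverseˡ (X j) = refl

switch-⁅⁆-outside : ∀ {n} (T : Tournament n) {u i j} → i ≢ u → j ≢ u →
                    arc (T ^ ⁅ u ⁆) i j ≡ arc T i j
switch-⁅⁆-outside T {u} i≢u j≢u = switch-agree T ⁅ u ⁆ (trans (⁅⁆-other i≢u) (sym (⁅⁆-other j≢u)))

switch-⁅⁆-from : ∀ {n} (T : Tournament n) {u j} → j ≢ u → arc (T ^ ⁅ u ⁆) u j ≡ arc T j u
switch-⁅⁆-from T {u} j≢u = switch-differ T ⁅ u ⁆ (trans (⁅⁆-self u) (cong not (sym (⁅⁆-other j≢u))))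

switch-⁅⁆-to : ∀ {n} (T : Tournament n) {u i} → i ≢ u → arc (T ^ ⁅ u ⁆) i u ≡ arc T u i
switch-⁅⁆-to T {u} i≢u = switch-differ T ⁅ u ⁆ (trans (⁅⁆-other i≢u) (cong not (sym (⁅⁆-self u))))

IsSource : ∀ {n} → Tournament n → Fin n → Set
IsSource T v = ∀ j → j ≢ v → arc T v j ≡ true

HasSource : ∀ {n} → Tournament n → Set
HasSource T = ∃ (IsSource T)

IsSourceWithout : ∀ {n} → Tournament n → Fin n → Fin n → Set
IsSourceWithout T s v = ∀ j → j ≢ s → j ≢ v → arc T v j ≡ true

isSourceWithout? : ∀ {n} (T : Tournament n) s v → Dec (IsSourceWithout T s v)
isSourceWithout? T s v = all? (λ j → ¬? (j ≟ s) →-dec ¬? (j ≟ v) →-dec (arc T v j ≟ᵇ true))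

loses⇒¬IsSource : ∀ {n} (T : Tournament n) {v j} → j ≢ v → arc T v j ≡ false → ¬ IsSource T v
loses⇒¬IsSource T {v} {j} j≢v v↛j source with trans (sym v↛j) (source j j≢v)
... | ()

switch-inNeighbours-source : ∀ {n} (T : Tournament n) v → IsSource (T ^ inNeighbours T v) v
switch-inNeighbours-source T v j j≢v with arc T v v | irreflexive T v | arc T j v in j→v
... | .false | refl | true  = refl
... | .false | refl | false = trans (antisym T j v j≢v) (cong not j→v)

Isomorphic-HasSource : ∀ {n} (T₁ T₂ : Tournament n) → Isomorphic T₁ T₂ → HasSource T₁ → HasSource T₂
Isomorphic-HasSource T₁ T₂ (σ , preserves) (v , source) = to v , to-source
  where
  open Inverse σ
  to-source : IsSource T₂ (to v)
  to-source j j≢σv = subst (λ k → arc T₂ (to v) k ≡ true) (strictlyInverseˡ j)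
    (trans (preserves v (from j))
           (source (from j) (λ from-j≡v → j≢σv (trans (sym (strictlyInverseˡ j)) (cong to from-j≡v)))))

switch-⁅source⁆-¬HasSource : ∀ {n} (T : Tournament n) {s j} → IsSource T s → j ≢ s →
  (∀ v → v ≢ s → ¬ IsSourceWithout T s v) → ¬ HasSource (T ^ ⁅ s ⁆)
switch-⁅source⁆-¬HasSource T {s} {j} s-source j≢s noRunnerUp (v , v-source) = case v ≟ s of λ
  { (yes refl) → loses⇒¬IsSource (T ^ ⁅ s ⁆) j≢s
                   (trans (switch-⁅⁆-from T j≢s) (arc-asym T (≢-sym j≢s) (s-source j j≢s))) v-source
  ; (no v≢s) → noRunnerUp v v≢s
                 (λ k k≢s k≢v → trans (sym (switch-⁅⁆-outside T v≢s k≢s)) (v-source k k≢v))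
  }

switch-⁅runnerUp⁆-¬HasSource : ∀ {n} (T : Tournament n) {s u w} → IsSource T s → u ≢ s →
  IsSourceWithout T s u → w ≢ s → w ≢ u → ¬ HasSource (T ^ ⁅ u ⁆)
switch-⁅runnerUp⁆-¬HasSource T {s} {u} {w} s-source u≢s u-runnerUp w≢s w≢u (v , v-source) =
  case ((v ≟ u) , (v ≟ s)) of λ
  { (yes refl , _) → loses⇒¬IsSource (T ^ ⁅ u ⁆) w≢u
      (trans (switch-⁅⁆-from T w≢u) (arc-asym T (≢-sym w≢u) (u-runnerUp w w≢s w≢u))) v-source
  ; (no v≢u , yes refl) → loses⇒¬IsSource (T ^ ⁅ u ⁆) u≢s
      (trans (switch-⁅⁆-to T (≢-sym u≢s)) (arc-asym T (≢-sym u≢s) (s-source u u≢s))) v-source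
  ; (no v≢u , no v≢s) → loses⇒¬IsSource (T ^ ⁅ u ⁆) (≢-sym v≢s)
      (trans (switch-⁅⁆-outside T v≢u (≢-sym u≢s)) (arc-asym T (≢-sym v≢s) (s-source v v≢s))) v-source
  }

avoid-zero-and : ∀ {m} (b : Fin (3 + m)) → ∃ λ w → w ≢ zero × w ≢ b
avoid-zero-and b with suc zero ≟ b
... | no 1≢b    = suc zero , (λ ()) , 1≢b
... | yes refl = suc (suc zero) , (λ ()) , (λ ())

avoid-two : ∀ {m} (a b : Fin (3 + m)) → ∃ λ w → w ≢ a × w ≢ b
avoid-two a b with zero ≟ a | zero ≟ b
... | no 0≢a  | no 0≢b  = zero , 0≢a , 0≢b
... | yes refl | _       = avoid-zero-and b
... | no _    | yes refl = map₂ swap (avoid-zero-and a)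

source-switchable-away : ∀ {m} (T : Tournament (3 + m)) s → IsSource T s → ∃ λ Y → ¬ HasSource (T ^ Y)
source-switchable-away T s s-source
  with any? (λ u → ¬? (u ≟ s) ×-dec isSourceWithout? T s u)
... | yes (u , u≢s , u-runnerUp) =
  let (w , w≢s , w≢u) = avoid-two s u
  in ⁅ u ⁆ , switch-⁅runnerUp⁆-¬HasSource T s-source u≢s u-runnerUp w≢s w≢u
... | no noRunnerUp =
  let (j , j≢s , _) = avoid-two s s
  in ⁅ s ⁆ , switch-⁅source⁆-¬HasSource T s-source j≢s (λ v v≢s v-runnerUp → noRunnerUp (v , v≢s , v-runnerUp))

corollary2p10 : (n : ℕ) → 2 < n → (T : Tournament n) →
    Σ (Tournament n) λ T₁ → Σ (Tournament n) λ T₂ →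
      SwitchingEquivalent T T₁ × SwitchingEquivalent T T₂ × ¬ Isomorphic T₁ T₂
corollary2p10 (suc (suc (suc m))) (s≤s (s≤s (s≤s _))) T =
  T₁ , T₁ ^ Y , (X , λ _ _ → refl) , (X ⊕ Y , switch-switch T X Y) ,
  λ T₁≅T₁^Y → T₁^Y-sourceless (Isomorphic-HasSource T₁ (T₁ ^ Y) T₁≅T₁^Y (zero , T₁-source))
  where
  X : Subset (3 + m)
  X = inNeighbours T zero
  T₁ : Tournament (3 + m)
  T₁ = T ^ X
  T₁-source : IsSource T₁ zero
  T₁-source = switch-inNeighbours-source T zero
  Y : Subset (3 + m)
  Y = proj₁ (source-switchable-away T₁ zero T₁-source)
  T₁^Y-sourceless : ¬ HasSource (T₁ ^ Y)
  T₁^Y-sourceless = proj₂ (source-switchable-away T₁ zero T₁-source)
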